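{- Let a graph $G$ of order $n$ be factored into graphs $H$ and $K$. If $G$ contains neither a cycle $C_4$ (as a subgraph) nor isolated vertices, then $n$ is even.
   Context: All graphs are finite and simple. A graph $G$ is factored into graphs $H$ and $K$ (all on $n$ vertices) if there exist adjacency matrices $A,B,C$ of $G,H,K$ respectively (symmetric $n\times n$ $(0,1)$-matrices with zero diagonal, for some vertex orderings) with $A=BC$; the three graphs are then regarded as having the common vertex set $\{1,\dots,n\}$. -}

module Defs where

open import Data.Nat using (ℕ; zero; suc; _+_; _*_)
open import Data.Fin using (Fin)
open import Data.Product using (_×_; ∃-syntax)
open import Data.Sum using (_⊎_)
open import Relation.Binary.PropositionalEquality using (_≡_; _≢_)

Matrix : ℕ → Set
Matrix n = Fin n → Fin n → ℕ

sumFin : {n : ℕ} → (Fin n → ℕ) → ℕ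
sumFin {zero}  f = 0
sumFin {suc n} f = f Fin.zero + sumFin (λ k → f (Fin.suc k))

_⊗_ : {n : ℕ} → Matrix n → Matrix n → Matrix n
(B ⊗ C) i j = sumFin (λ k → B i k * C k j)

record IsAdjacency {n : ℕ} (A : Matrix n) : Set where
  field
    zero-one  : ∀ i j → A i j ≡ 0 ⊎ A i j ≡ 1
    symmetric : ∀ i j → A i j ≡ A j i
    zero-diag : ∀ i → A i i ≡ 0

Adj : {n : ℕ} → Matrix n → Fin n → Fin n → Set
Adj A i j = A i j ≡ 1

HasC4 : {n : ℕ} → Matrix n → Set
HasC4 {n} A = ∃[ a ] ∃[ b ] ∃[ c ] ∃[ d ]
  ( (a ≢ b × a ≢ c × a ≢ d × b ≢ c × b ≢ d × c ≢ d)
  × Adj A a b × Adj A b c × Adj A c d × Adj A d a )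

Isolated : {n : ℕ} → Matrix n → Fin n → Set
Isolated {n} A i = ∀ (j : Fin n) → A i j ≡ 0

Factored : {n : ℕ} → Matrix n → Matrix n → Matrix n → Set
Factored A B C = IsAdjacency A × IsAdjacency B × IsAdjacency C × (∀ i j → A i j ≡ (B ⊗ C) i j)

{-# OPTIONS --safe #-}
module Submission where

-- Since A = BC is symmetric, also A = CB, and the edge sets of B and C are disjoint.
-- A vertex with two B-neighbours k₁, k₂ and two C-neighbours m₁, m₂ would close the
-- 4-cycle k₁ m₁ k₂ m₂ in G; as G has no isolated vertex, every vertex has B- and
-- C-neighbours, and its B- or its C-neighbour is unique.
-- Call v B-paired when v and some w are each other's only B-neighbours.  Comparing the
-- B–C and C–B paths of length two shows that a vertex which is not B-paired is C-paired
-- with a vertex which is not B-paired either.  Hence the isolated edges of B, together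
-- with the isolated edges of C between vertices that are not B-paired, form a perfect
-- matching on the n vertices, and n is even by the handshake lemma.

open import Defs
open import Data.Nat using (ℕ)
open import Data.Nat.Divisibility using (_∣_)
open import Data.Fin using (Fin)
open import Relation.Nullary using (¬_)

open import Data.Fin using (zero; suc; _≟_)
open import Data.Fin.Properties using (any?; suc-injective)
open import Data.Nat using (zero; suc; _+_; _*_; _∸_; _≤_; z≤n)
open import Data.Nat.Divisibility using (_∣0; m∣m*n; ∣m∣n⇒∣m+n)
open import Data.Nat.Properties
  using (+-0-commutativeMonoid; +-comm; +-assoc; +-identityʳ; *-comm; *-zeroʳ; *-identityˡ;
         ≤-trans; ≤-reflexive; m≤m+n; m≤n+m; +-monoʳ-≤; 1+n≰n)
  renaming (_≟_ to _≟ℕ_)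
open import Data.Product using (_×_; _,_; proj₁; proj₂; ∃-syntax)
open import Data.Sum using (_⊎_; inj₁; inj₂)
open import Function using (_∘_)
open import Relation.Binary.PropositionalEquality
open import Relation.Nullary using (yes; no; contradiction)
open import Relation.Nullary.Decidable using (¬?; _×-dec_; decidable-stable)

import Algebra.Properties.CommutativeMonoid.Sum
open Algebra.Properties.CommutativeMonoid.Sum +-0-commutativeMonoid
  using (sum; sum-cong-≗; sum-replicate-zero; ∑-distrib-+)

sumFin≡sum : ∀ {n} (f : Fin n → ℕ) → sumFin f ≡ sum f
sumFin≡sum {zero}  f = refl
sumFin≡sum {suc n} f = cong (f zero +_) (sumFin≡sum (f ∘ suc))

sum-zero : ∀ {n} {f : Fin n → ℕ} → (∀ i → f i ≡ 0) → sum f ≡ 0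
sum-zero {n} f≡0 = trans (sum-cong-≗ f≡0) (sum-replicate-zero n)

sum-replicate-1 : ∀ n → sum {n} (λ _ → 1) ≡ n
sum-replicate-1 zero    = refl
sum-replicate-1 (suc n) = cong suc (sum-replicate-1 n)

sum-single : ∀ {n} (f : Fin n → ℕ) i → (∀ j → j ≢ i → f j ≡ 0) → sum f ≡ f i
sum-single f zero    others = trans (cong (f zero +_) (sum-zero (λ j → others (suc j) λ ()))) (+-identityʳ _)
sum-single f (suc i) others = cong₂ _+_ (others zero λ ())
  (sum-single (f ∘ suc) i (λ j j≢i → others (suc j) (j≢i ∘ suc-injective)))

≤-sum : ∀ {n} (f : Fin n → ℕ) i → f i ≤ sum f
≤-sum f zero    = m≤m+n _ _
≤-sum f (suc i) = ≤-trans (≤-sum (f ∘ suc) i) (m≤n+m _ _)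

+-≤-sum : ∀ {n} (f : Fin n → ℕ) {i j} → i ≢ j → f i + f j ≤ sum f
+-≤-sum f {zero}  {zero}  i≢j = contradiction refl i≢j
+-≤-sum f {zero}  {suc j} _   = +-monoʳ-≤ (f zero) (≤-sum (f ∘ suc) j)
+-≤-sum f {suc i} {zero}  _   = ≤-trans (≤-reflexive (+-comm (f (suc i)) (f zero)))
                                        (+-monoʳ-≤ (f zero) (≤-sum (f ∘ suc) i))
+-≤-sum f {suc i} {suc j} i≢j = ≤-trans (+-≤-sum (f ∘ suc) (i≢j ∘ cong suc)) (m≤n+m _ _)

sum≢0⇒∃≢0 : ∀ {n} (f : Fin n → ℕ) → sum f ≢ 0 → ∃[ i ] f i ≢ 0
sum≢0⇒∃≢0 {zero}  f ∑≢0 = contradiction refl ∑≢0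
sum≢0⇒∃≢0 {suc n} f ∑≢0 with f zero ≟ℕ 0
... | no  f₀≢0 = zero , f₀≢0
... | yes f₀≡0 with sum≢0⇒∃≢0 (f ∘ suc) (λ ∑≡0 → ∑≢0 (cong₂ _+_ f₀≡0 ∑≡0))
...   | i , fᵢ≢0 = suc i , fᵢ≢0

Symmetric : ∀ {n} → Matrix n → Set
Symmetric M = ∀ i j → M i j ≡ M j i

ZeroDiagonal : ∀ {n} → Matrix n → Set
ZeroDiagonal M = ∀ i → M i i ≡ 0

deg : ∀ {n} → Matrix n → Fin n → ℕ
deg M i = sum (M i)

handshake : ∀ {n} (M : Matrix n) → Symmetric M → ZeroDiagonal M → 2 ∣ sum (deg M)
handshake {zero}  M M-sym M-diag = 2 ∣0
handshake {suc n} M M-sym M-diag =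
  subst (2 ∣_) (sym total)
        (∣m∣n⇒∣m+n (m∣m*n S) (handshake M′ (λ i j → M-sym (suc i) (suc j)) (M-diag ∘ suc)))
  where
  open ≡-Reasoning
  M′ : Matrix n
  M′ i j = M (suc i) (suc j)
  S R : ℕ
  S = sum (λ j → M zero (suc j))
  R = sum (deg M′)
  total : sum (deg M) ≡ 2 * S + R
  total = begin
    M zero zero + S + sum (λ i → M (suc i) zero + deg M′ i)
      ≡⟨ cong₂ _+_ (cong (_+ S) (M-diag zero)) (∑-distrib-+ (λ i → M (suc i) zero) (deg M′)) ⟩
    S + (sum (λ i → M (suc i) zero) + R)
      ≡⟨ cong (λ t → S + (t + R)) (sum-cong-≗ (λ i → M-sym (suc i) zero)) ⟩
    S + (S + R)
      ≡⟨ sym (+-assoc S S R) ⟩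
    S + S + R
      ≡⟨ cong (λ t → S + t + R) (sym (+-identityʳ S)) ⟩
    2 * S + R ∎

1-regular⇒2∣n : ∀ {n} (M : Matrix n) → Symmetric M → ZeroDiagonal M → (∀ i → deg M i ≡ 1) → 2 ∣ n
1-regular⇒2∣n {n} M M-sym M-diag deg≡1 =
  subst (2 ∣_) (trans (sum-cong-≗ deg≡1) (sum-replicate-1 n)) (handshake M M-sym M-diag)

open IsAdjacency

OnlyNeighbour : ∀ {n} → Matrix n → Fin n → Fin n → Set
OnlyNeighbour M v w = Adj M v w × (∀ u → Adj M v u → u ≡ w)

TwoNeighbours : ∀ {n} → Matrix n → Fin n → Set
TwoNeighbours M v = ∃[ u ] ∃[ w ] u ≢ w × Adj M v u × Adj M v w

onlyNeighbour⊎twoNeighbours : ∀ {n} {M : Matrix n} {v w} → Adj M v w → OnlyNeighbour M v w ⊎ TwoNeighbours M v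
onlyNeighbour⊎twoNeighbours {M = M} {v} {w} vw with any? (λ u → ¬? (u ≟ w) ×-dec (M v u ≟ℕ 1))
... | yes (u , u≢w , vu) = inj₂ (u , w , u≢w , vu , vw)
... | no ∄u = inj₁ (vw , λ u vu → decidable-stable (u ≟ w) (λ u≢w → ∄u (u , u≢w , vu)))

onlyNeighbour-unless-two : ∀ {n} {M : Matrix n} {v w} → Adj M v w → ¬ TwoNeighbours M v → OnlyNeighbour M v w
onlyNeighbour-unless-two {M = M} vw ¬two with onlyNeighbour⊎twoNeighbours {M = M} vw
... | inj₁ only = only
... | inj₂ two  = contradiction two ¬two

twoNeighbours⇒deg≢1 : ∀ {n} {M : Matrix n} {v} → TwoNeighbours M v → deg M v ≢ 1
twoNeighbours⇒deg≢1 {M = M} {v} (u , w , u≢w , vu , vw) deg≡1 =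
  1+n≰n (subst₂ _≤_ (cong₂ _+_ vu vw) deg≡1 (+-≤-sum (M v) u≢w))

module _ {n : ℕ} {M : Matrix n} (M-adj : IsAdjacency M) where

  adj-sym : ∀ {i j} → Adj M i j → Adj M j i
  adj-sym {i} {j} ij = trans (symmetric M-adj j i) ij

  ¬adj⇒≡0 : ∀ {i j} → ¬ Adj M i j → M i j ≡ 0
  ¬adj⇒≡0 {i} {j} ¬ij with zero-one M-adj i j
  ... | inj₁ ≡0 = ≡0
  ... | inj₂ ≡1 = contradiction ≡1 ¬ij

  ≢0⇒adj : ∀ {i j} → M i j ≢ 0 → Adj M i j
  ≢0⇒adj {i} {j} ≢0 with zero-one M-adj i j
  ... | inj₁ ≡0 = contradiction ≡0 ≢0
  ... | inj₂ ≡1 = ≡1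

  entry≤1 : ∀ i j → M i j ≤ 1
  entry≤1 i j with zero-one M-adj i j
  ... | inj₁ ≡0 = subst (_≤ 1) (sym ≡0) z≤n
  ... | inj₂ ≡1 = ≤-reflexive ≡1

  onlyNeighbour⇒≡0 : ∀ {v w} → OnlyNeighbour M v w → ∀ u → u ≢ w → M v u ≡ 0
  onlyNeighbour⇒≡0 (_ , only) u u≢w = ¬adj⇒≡0 (u≢w ∘ only u)

  onlyNeighbour⇒deg≡1 : ∀ {v w} → OnlyNeighbour M v w → deg M v ≡ 1
  onlyNeighbour⇒deg≡1 {v} {w} only = trans (sum-single (M v) w (onlyNeighbour⇒≡0 only)) (proj₁ only)

  sum-onlyNeighbour : ∀ {v w} → OnlyNeighbour M v w → (g : Fin n → ℕ) → sum (λ u → M v u * g u) ≡ g w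
  sum-onlyNeighbour {v} {w} only g = begin
    sum (λ u → M v u * g u) ≡⟨ sum-single _ w (λ u u≢w → cong (_* g u) (onlyNeighbour⇒≡0 only u u≢w)) ⟩
    M v w * g w             ≡⟨ cong (_* g w) (proj₁ only) ⟩
    1 * g w                 ≡⟨ *-identityˡ (g w) ⟩
    g w                     ∎
    where open ≡-Reasoning

module Product {n : ℕ} {A P Q : Matrix n} (A-adj : IsAdjacency A) (P-adj : IsAdjacency P)
               (Q-adj : IsAdjacency Q) (A≡PQ : ∀ i j → A i j ≡ (P ⊗ Q) i j) where

  private
    entry : ∀ i j → A i j ≡ sum (λ k → P i k * Q k j)
    entry i j = trans (A≡PQ i j) (sumFin≡sum (λ k → P i k * Q k j))

  path : ∀ {i k j} → Adj P i k → Adj Q k j → Adj A i j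
  path {i} {k} {j} ik kj = ≢0⇒adj A-adj λ Aij≡0 →
    contradiction (subst₂ _≤_ (cong₂ _*_ ik kj) (trans (sym (entry i j)) Aij≡0) (≤-sum _ k)) λ ()

  middle-unique : ∀ {i k k′ j} → Adj P i k → Adj Q k j → Adj P i k′ → Adj Q k′ j → k ≡ k′
  middle-unique {i} {k} {k′} {j} ik kj ik′ k′j =
    decidable-stable (k ≟ k′) λ k≢k′ → 1+n≰n (≤-trans
      (subst (_≤ A i j) (cong₂ _+_ (cong₂ _*_ ik kj) (cong₂ _*_ ik′ k′j))
             (subst (_ ≤_) (sym (entry i j)) (+-≤-sum (λ k → P i k * Q k j) k≢k′)))
      (entry≤1 A-adj i j))

  middle-exists : ∀ {i j} → Adj A i j → ∃[ k ] Adj P i k × Adj Q k j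
  middle-exists {i} {j} ij
    with sum≢0⇒∃≢0 (λ k → P i k * Q k j)
                   (λ ∑≡0 → contradiction (trans (sym ij) (trans (entry i j) ∑≡0)) λ ())
  ... | k , ≢0 = k , ≢0⇒adj P-adj (λ ≡0 → ≢0 (cong (_* Q k j) ≡0))
                   , ≢0⇒adj Q-adj (λ ≡0 → ≢0 (trans (cong (P i k *_) ≡0) (*-zeroʳ (P i k))))

factored-swap : ∀ {n} {A B C : Matrix n} → Factored A B C → Factored A C B
factored-swap {A = A} {B} {C} (A-adj , B-adj , C-adj , A≡BC) = A-adj , C-adj , B-adj , A≡CB
  where
  A≡CB : ∀ i j → A i j ≡ (C ⊗ B) i j
  A≡CB i j = begin
    A i j                          ≡⟨ symmetric A-adj i j ⟩
    A j i                          ≡⟨ A≡BC j i ⟩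
    sumFin (λ k → B j k * C k i)   ≡⟨ sumFin≡sum (λ k → B j k * C k i) ⟩
    sum (λ k → B j k * C k i)      ≡⟨ sum-cong-≗ (λ k → trans (cong₂ _*_ (symmetric B-adj j k) (symmetric C-adj k i))
                                                               (*-comm (B k j) (C i k))) ⟩
    sum (λ k → C i k * B k j)      ≡⟨ sumFin≡sum (λ k → C i k * B k j) ⟨
    sumFin (λ k → C i k * B k j)   ∎
    where open ≡-Reasoning

NoIsolated : ∀ {n} → Matrix n → Set
NoIsolated {n} A = ∀ (i : Fin n) → ¬ Isolated A i

module Factorisation {n : ℕ} {A X Y : Matrix n} (fac : Factored A X Y) (noIsolated : NoIsolated A) where

  private
    A-adj : IsAdjacency A
    A-adj = proj₁ fac
    X-adj : IsAdjacency X
    X-adj = proj₁ (proj₂ fac)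
    Y-adj : IsAdjacency Y
    Y-adj = proj₁ (proj₂ (proj₂ fac))

  open Product A-adj X-adj Y-adj (proj₂ (proj₂ (proj₂ fac)))
    using () renaming (path to XY-path; middle-exists to XY-middle-exists)
  open Product A-adj Y-adj X-adj (proj₂ (proj₂ (proj₂ (factored-swap fac))))
    using () renaming (path to YX-path; middle-unique to YX-middle-unique)

  X-neighbour≢Y-neighbour : ∀ {v k m} → Adj X v k → Adj Y v m → k ≢ m
  X-neighbour≢Y-neighbour {v} vk vm refl =
    contradiction (trans (sym (XY-path vk (adj-sym Y-adj vm))) (zero-diag A-adj v)) λ ()

  has-X-neighbour : ∀ v → ∃[ k ] Adj X v k
  has-X-neighbour v with any? (λ j → A v j ≟ℕ 1)
  ... | no  ∄j     = contradiction (λ j → ¬adj⇒≡0 A-adj (λ vj → ∄j (j , vj))) (noIsolated v)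
  ... | yes (j , vj) with XY-middle-exists vj
  ...   | k , vk , _ = k , vk

  twoNeighbours-X-and-Y⇒C4 : ∀ {v} → TwoNeighbours X v → TwoNeighbours Y v → HasC4 A
  twoNeighbours-X-and-Y⇒C4 (k₁ , k₂ , k₁≢k₂ , vk₁ , vk₂) (m₁ , m₂ , m₁≢m₂ , vm₁ , vm₂) =
    k₁ , m₁ , k₂ , m₂
    , ( X-neighbour≢Y-neighbour vk₁ vm₁ , k₁≢k₂ , X-neighbour≢Y-neighbour vk₁ vm₂
      , X-neighbour≢Y-neighbour vk₂ vm₁ ∘ sym , m₁≢m₂ , X-neighbour≢Y-neighbour vk₂ vm₂ )
    , edge vk₁ vm₁ , adj-sym A-adj (edge vk₂ vm₁) , edge vk₂ vm₂ , adj-sym A-adj (edge vk₁ vm₂)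
    where
    edge : ∀ {v k m} → Adj X v k → Adj Y v m → Adj A k m
    edge vk vm = XY-path (adj-sym X-adj vk) vm

  -- A Y–X path v u z is matched by an X–Y path, whose middle vertex must be w.
  square : ∀ {v w u z} → OnlyNeighbour X v w → Adj Y v u → Adj X u z → Adj Y w z
  square {z = z} (_ , only) vu uz with XY-middle-exists (YX-path vu uz)
  ... | t , vt , tz = subst (λ t → Adj Y t z) (only t vt) tz

  onlyNeighbour-square : ∀ {v w u z} → OnlyNeighbour X v w → Adj Y v u → OnlyNeighbour Y w z → OnlyNeighbour X u z
  onlyNeighbour-square {u = u} v-w vu (_ , w-only) with has-X-neighbour u
  ... | z′ , uz′ = subst (Adj X u) (w-only z′ (square v-w vu uz′)) uz′
                 , λ z″ uz″ → w-only z″ (square v-w vu uz″)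

  twoNeighbours-transfer : ∀ {v w} → OnlyNeighbour X v w → TwoNeighbours Y v → TwoNeighbours Y w
  twoNeighbours-transfer v-w (u₁ , u₂ , u₁≢u₂ , vu₁ , vu₂) with has-X-neighbour u₁ | has-X-neighbour u₂
  ... | z₁ , u₁z₁ | z₂ , u₂z₂ = z₁ , z₂ , z₁≢z₂ , square v-w vu₁ u₁z₁ , square v-w vu₂ u₂z₂
    where
    z₁≢z₂ : z₁ ≢ z₂
    z₁≢z₂ refl = u₁≢u₂ (YX-middle-unique vu₁ u₁z₁ vu₂ u₂z₂)

PairedWith : ∀ {n} → Matrix n → Fin n → Fin n → Set
PairedWith M v w = OnlyNeighbour M v w × OnlyNeighbour M w v

Unpaired : ∀ {n} → Matrix n → Fin n → Set
Unpaired M v = TwoNeighbours M v ⊎ ∃[ w ] OnlyNeighbour M v w × TwoNeighbours M w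

paired⊎unpaired : ∀ {n} {M : Matrix n} → IsAdjacency M → ∀ {v w} → Adj M v w
                → (∃[ w ] PairedWith M v w) ⊎ Unpaired M v
paired⊎unpaired {M = M} M-adj {v} {w} vw with onlyNeighbour⊎twoNeighbours {M = M} vw
... | inj₂ v-two = inj₂ (inj₁ v-two)
... | inj₁ v-w with onlyNeighbour⊎twoNeighbours {M = M} (adj-sym M-adj vw)
...   | inj₁ w-v   = inj₁ (w , v-w , w-v)
...   | inj₂ w-two = inj₂ (inj₂ (w , v-w , w-two))

mask : ∀ {n} → Matrix n → (Fin n → ℕ) → Matrix n
mask M m i j = M i j * (m i * m j)

isOne : ℕ → ℕ
isOne 1 = 1
isOne _ = 0

isOne-≢1 : ∀ {d} → d ≢ 1 → isOne d ≡ 0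
isOne-≢1 {zero}        _   = refl
isOne-≢1 {suc zero}    d≢1 = contradiction refl d≢1
isOne-≢1 {suc (suc d)} _   = refl

isLeaf : ∀ {n} → Matrix n → Fin n → ℕ
isLeaf M i = isOne (deg M i)

isolatedEdges : ∀ {n} → Matrix n → Matrix n
isolatedEdges M = mask M (isLeaf M)

_+ᴹ_ : ∀ {n} → Matrix n → Matrix n → Matrix n
(M +ᴹ N) i j = M i j + N i j

-- 1 ∸ deg (isolatedEdges X) i is the indicator of "i is not X-paired", as that degree is 0 or 1.
unpairedLeaf : ∀ {n} → Matrix n → Matrix n → Fin n → ℕ
unpairedLeaf X Y i = isLeaf Y i * (1 ∸ deg (isolatedEdges X) i)

matching : ∀ {n} → Matrix n → Matrix n → Matrix n
matching X Y = isolatedEdges X +ᴹ mask Y (unpairedLeaf X Y)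

mask-symmetric : ∀ {n} {M : Matrix n} → Symmetric M → ∀ m → Symmetric (mask M m)
mask-symmetric M-sym m i j = cong₂ _*_ (M-sym i j) (*-comm (m i) (m j))

mask-zeroDiagonal : ∀ {n} {M : Matrix n} → ZeroDiagonal M → ∀ m → ZeroDiagonal (mask M m)
mask-zeroDiagonal M-diag m i = cong (_* (m i * m i)) (M-diag i)

deg-mask-zero : ∀ {n} (M : Matrix n) m {i} → m i ≡ 0 → deg (mask M m) i ≡ 0
deg-mask-zero M m {i} mᵢ≡0 = sum-zero λ j → trans (cong (λ t → M i j * (t * m j)) mᵢ≡0) (*-zeroʳ (M i j))

+ᴹ-symmetric : ∀ {n} {M N : Matrix n} → Symmetric M → Symmetric N → Symmetric (M +ᴹ N)
+ᴹ-symmetric M-sym N-sym i j = cong₂ _+_ (M-sym i j) (N-sym i j)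

+ᴹ-zeroDiagonal : ∀ {n} {M N : Matrix n} → ZeroDiagonal M → ZeroDiagonal N → ZeroDiagonal (M +ᴹ N)
+ᴹ-zeroDiagonal M-diag N-diag i = cong₂ _+_ (M-diag i) (N-diag i)

deg-+ᴹ : ∀ {n} (M N : Matrix n) i → deg (M +ᴹ N) i ≡ deg M i + deg N i
deg-+ᴹ M N i = ∑-distrib-+ (M i) (N i)

module _ {n : ℕ} {M : Matrix n} (M-adj : IsAdjacency M) where

  deg-mask-onlyNeighbour : ∀ m {i j} → OnlyNeighbour M i j → deg (mask M m) i ≡ m i * m j
  deg-mask-onlyNeighbour m {i} i-j = sum-onlyNeighbour M-adj i-j (λ j → m i * m j)

  deg-isolatedEdges-paired : ∀ {i j} → PairedWith M i j → deg (isolatedEdges M) i ≡ 1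
  deg-isolatedEdges-paired (i-j , j-i) = trans (deg-mask-onlyNeighbour (isLeaf M) i-j)
    (cong₂ _*_ (cong isOne (onlyNeighbour⇒deg≡1 M-adj i-j)) (cong isOne (onlyNeighbour⇒deg≡1 M-adj j-i)))

  deg-isolatedEdges-unpaired : ∀ {i} → Unpaired M i → deg (isolatedEdges M) i ≡ 0
  deg-isolatedEdges-unpaired (inj₁ i-two) =
    deg-mask-zero M (isLeaf M) (isOne-≢1 (twoNeighbours⇒deg≢1 {M = M} i-two))
  deg-isolatedEdges-unpaired {i} (inj₂ (j , i-j , j-two)) = trans (deg-mask-onlyNeighbour (isLeaf M) i-j)
    (trans (cong (isLeaf M i *_) (isOne-≢1 (twoNeighbours⇒deg≢1 {M = M} j-two))) (*-zeroʳ (isLeaf M i)))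

module Matching {n : ℕ} {X Y : Matrix n} (X-adj : IsAdjacency X) (Y-adj : IsAdjacency Y) where

  matching-symmetric : Symmetric (matching X Y)
  matching-symmetric = +ᴹ-symmetric {M = isolatedEdges X} {mask Y (unpairedLeaf X Y)}
    (mask-symmetric {M = X} (symmetric X-adj) (isLeaf X))
    (mask-symmetric {M = Y} (symmetric Y-adj) (unpairedLeaf X Y))

  matching-zeroDiagonal : ZeroDiagonal (matching X Y)
  matching-zeroDiagonal = +ᴹ-zeroDiagonal {M = isolatedEdges X} {mask Y (unpairedLeaf X Y)}
    (mask-zeroDiagonal {M = X} (zero-diag X-adj) (isLeaf X))
    (mask-zeroDiagonal {M = Y} (zero-diag Y-adj) (unpairedLeaf X Y))

  unpairedLeaf-paired : ∀ {i j} → PairedWith X i j → unpairedLeaf X Y i ≡ 0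
  unpairedLeaf-paired {i} i-j =
    trans (cong (λ d → isLeaf Y i * (1 ∸ d)) (deg-isolatedEdges-paired X-adj i-j)) (*-zeroʳ (isLeaf Y i))

  unpairedLeaf-unpaired : ∀ {i j} → OnlyNeighbour Y i j → Unpaired X i → unpairedLeaf X Y i ≡ 1
  unpairedLeaf-unpaired i-j i-unpaired =
    cong₂ _*_ (cong isOne (onlyNeighbour⇒deg≡1 Y-adj i-j))
              (cong (1 ∸_) (deg-isolatedEdges-unpaired X-adj i-unpaired))

  deg-matching-paired : ∀ {i j} → PairedWith X i j → deg (matching X Y) i ≡ 1
  deg-matching-paired {i} i-j = begin
    deg (matching X Y) i
      ≡⟨ deg-+ᴹ (isolatedEdges X) (mask Y (unpairedLeaf X Y)) i ⟩
    deg (isolatedEdges X) i + deg (mask Y (unpairedLeaf X Y)) i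
      ≡⟨ cong₂ _+_ (deg-isolatedEdges-paired X-adj i-j)
                   (deg-mask-zero Y (unpairedLeaf X Y) (unpairedLeaf-paired i-j)) ⟩
    1 + 0 ∎
    where open ≡-Reasoning

  deg-matching-unpaired : ∀ {i j} → Unpaired X i → PairedWith Y i j → Unpaired X j → deg (matching X Y) i ≡ 1
  deg-matching-unpaired {i} {j} i-unpaired (i-j , j-i) j-unpaired = begin
    deg (matching X Y) i
      ≡⟨ deg-+ᴹ (isolatedEdges X) (mask Y (unpairedLeaf X Y)) i ⟩
    deg (isolatedEdges X) i + deg (mask Y (unpairedLeaf X Y)) i
      ≡⟨ cong₂ _+_ (deg-isolatedEdges-unpaired X-adj i-unpaired)
                   (deg-mask-onlyNeighbour Y-adj (unpairedLeaf X Y) i-j) ⟩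
    0 + unpairedLeaf X Y i * unpairedLeaf X Y j
      ≡⟨ cong₂ _*_ (unpairedLeaf-unpaired i-j i-unpaired) (unpairedLeaf-unpaired j-i j-unpaired) ⟩
    1 * 1 ∎
    where open ≡-Reasoning

module C4FreeFactorisation {n : ℕ} {A X Y : Matrix n} (fac : Factored A X Y) (noC4 : ¬ HasC4 A)
                           (noIsolated : NoIsolated A) where

  private
    X-adj : IsAdjacency X
    X-adj = proj₁ (proj₂ fac)
    Y-adj : IsAdjacency Y
    Y-adj = proj₁ (proj₂ (proj₂ fac))

  open Factorisation fac noIsolated
  module YX = Factorisation (factored-swap fac) noIsolated

  ¬twoNeighbours-X-and-Y : ∀ {v} → TwoNeighbours X v → ¬ TwoNeighbours Y v
  ¬twoNeighbours-X-and-Y X-two Y-two = noC4 (twoNeighbours-X-and-Y⇒C4 X-two Y-two)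

  onlyY-unless-twoX : ∀ {v u} → Adj Y v u → TwoNeighbours X v → OnlyNeighbour Y v u
  onlyY-unless-twoX vu X-two = onlyNeighbour-unless-two {M = Y} vu (¬twoNeighbours-X-and-Y X-two)

  unpaired⇒pairedWith-unpaired : ∀ {v} → Unpaired X v → ∃[ u ] PairedWith Y v u × Unpaired X u
  unpaired⇒pairedWith-unpaired {v} (inj₁ v-two) with YX.has-X-neighbour v
  ... | u , vu = u , (v-u , u-v) , inj₁ u-two
    where
    v-u : OnlyNeighbour Y v u
    v-u = onlyY-unless-twoX vu v-two
    u-two : TwoNeighbours X u
    u-two = YX.twoNeighbours-transfer v-u v-two
    u-v : OnlyNeighbour Y u v
    u-v = onlyY-unless-twoX (adj-sym Y-adj vu) u-two
  unpaired⇒pairedWith-unpaired {v} (inj₂ (w , v-w , w-two)) with YX.has-X-neighbour w | YX.has-X-neighbour v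
  ... | z , wz | u , vu = u , (v-u , u-v) , inj₂ (z , u-z , z-two)
    where
    w-z : OnlyNeighbour Y w z
    w-z = onlyY-unless-twoX wz w-two
    v-u : OnlyNeighbour Y v u
    v-u = onlyNeighbour-unless-two {M = Y} vu (¬twoNeighbours-X-and-Y w-two ∘ twoNeighbours-transfer v-w)
    u-z : OnlyNeighbour X u z
    u-z = onlyNeighbour-square v-w vu w-z
    z-two : TwoNeighbours X z
    z-two = YX.twoNeighbours-transfer w-z w-two
    u-v : OnlyNeighbour Y u v
    u-v = onlyNeighbour-unless-two {M = Y} (adj-sym Y-adj vu)
                                   (¬twoNeighbours-X-and-Y z-two ∘ twoNeighbours-transfer u-z)

  open Matching X-adj Y-adj

  deg-matching≡1 : ∀ v → deg (matching X Y) v ≡ 1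
  deg-matching≡1 v with paired⊎unpaired {M = X} X-adj (proj₂ (has-X-neighbour v))
  ... | inj₁ (w , v-w)  = deg-matching-paired v-w
  ... | inj₂ v-unpaired with unpaired⇒pairedWith-unpaired v-unpaired
  ...   | u , v-u , u-unpaired = deg-matching-unpaired v-unpaired v-u u-unpaired

lemma7p1 : (n : ℕ) (A B C : Matrix n) → Factored A B C → ¬ HasC4 A
           → (∀ (i : Fin n) → ¬ Isolated A i) → 2 ∣ n
lemma7p1 n A B C fac@(_ , B-adj , C-adj , _) noC4 noIsolated =
  1-regular⇒2∣n (matching B C) matching-symmetric matching-zeroDiagonal
                (C4FreeFactorisation.deg-matching≡1 fac noC4 noIsolated)
  where open Matching B-adj C-adj
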